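{- Let $II_n=\sum_{\iota\in\mathcal{I}_n(321)} q^{\mathrm{inv}(\iota)}$ (so $II_0=1$) and let $IF_n=\sum_{\iota\in F\mathcal{I}_n(321)} q^{\mathrm{inv}(\iota)}$ (so $IF_0=1$ and $IF_n=0$ for $n$ odd). Then $II_1=1$ and for $n>1$, $$II_n = IF_n + \sum_{k=0}^{\lceil n/2\rceil-1} IF_{2k}\, II_{n-2k-1}.$$
   Context: A permutation $\sigma$ of $[n]$ (one-line notation) contains a pattern $\pi\in\mathfrak{S}_k$ if some subsequence $\sigma(m_1)\cdots\sigma(m_k)$ with $m_1<\dots<m_k$ is in the same relative order as $\pi$; otherwise it avoids $\pi$. An involution is a permutation with $\iota^2=\mathrm{id}$; it is fixed-point-free if $\iota(i)\ne i$ for all $i$. $\mathcal{I}_n(\pi)$ (resp. $F\mathcal{I}_n(\pi)$) is the set of involutions (resp. fixed-point-free involutions) of $[n]$ avoiding $\pi$; for $n=0$ these consist of the empty permutation. $\mathrm{inv}(\sigma)$ is the number of pairs $i<j$ with $\sigma(i)>\sigma(j)$. -}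

module Defs where

open import Level using (Level)
open import Data.Nat using (ℕ; zero; suc) renaming (_+_ to _+ℕ_)
open import Data.Fin using (Fin; _<?_; _≟_)
open import Data.Fin.Base using (_<_)
open import Data.Vec using (Vec; []; _∷_; lookup)
open import Data.List using (List; []; _∷_; concatMap; map; filterᵇ; length)
open import Data.List.Base using (allFin; filter)
open import Data.Bool using (Bool; true; false; _∧_; _∨_; not)
open import Relation.Nullary.Decidable using (⌊_⌋)
open import Algebra.Bundles using (CommutativeSemiring)

-- A permutation of [n] in one-line notation: the word σ(1)…σ(n),
-- stored as a vector of length n over Fin n (positions/values 0-indexed).
Word : ℕ → Set
Word n = Vec (Fin n) n

allVecs : (n m : ℕ) → List (Vec (Fin n) m)
allVecs n zero = [] ∷ []
allVecs n (suc m) = concatMap (λ x → map (x ∷_) (allVecs n m)) (allFin n)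

anyL : {A : Set} → (A → Bool) → List A → Bool
anyL p [] = false
anyL p (x ∷ xs) = p x ∨ anyL p xs

allL : {A : Set} → (A → Bool) → List A → Bool
allL p [] = true
allL p (x ∷ xs) = p x ∧ allL p xs

ltᵇ : {n : ℕ} → Fin n → Fin n → Bool
ltᵇ i j = ⌊ i <? j ⌋

eqᵇ : {n : ℕ} → Fin n → Fin n → Bool
eqᵇ i j = ⌊ i ≟ j ⌋

isInvolution : {n : ℕ} → Word n → Bool
isInvolution {n} ι = allL (λ i → eqᵇ (lookup ι (lookup ι i)) i) (allFin n)

isFixedPointFree : {n : ℕ} → Word n → Bool
isFixedPointFree {n} ι = allL (λ i → not (eqᵇ (lookup ι i) i)) (allFin n)

contains321 : {n : ℕ} → Word n → Bool
contains321 {n} σ =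
  anyL (λ i → anyL (λ j → anyL (λ k →
     ltᵇ i j ∧ ltᵇ j k ∧ ltᵇ (lookup σ j) (lookup σ i) ∧ ltᵇ (lookup σ k) (lookup σ j))
     (allFin n)) (allFin n)) (allFin n)

avoids321 : {n : ℕ} → Word n → Bool
avoids321 σ = not (contains321 σ)

countL : {A : Set} → (A → Bool) → List A → ℕ
countL p xs = length (filterᵇ p xs)

sumℕ : List ℕ → ℕ
sumℕ [] = 0
sumℕ (x ∷ xs) = x +ℕ sumℕ xs

inv : {n : ℕ} → Word n → ℕ
inv {n} σ = sumℕ (map (λ i → countL (λ j → ltᵇ i j ∧ ltᵇ (lookup σ j) (lookup σ i)) (allFin n)) (allFin n))

Inv321 : (n : ℕ) → List (Word n)
Inv321 n = filterᵇ (λ ι → isInvolution ι ∧ avoids321 ι) (allVecs n n)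

FInv321 : (n : ℕ) → List (Word n)
FInv321 n = filterᵇ (λ ι → isInvolution ι ∧ isFixedPointFree ι ∧ avoids321 ι) (allVecs n n)

-- Generating polynomials, evaluated at an arbitrary element q of an
-- arbitrary commutative semiring (a polynomial identity in ℕ[q] is the
-- same as such an identity holding universally).
module GF {c ℓ : Level} (R : CommutativeSemiring c ℓ) where
  open CommutativeSemiring R

  pow : Carrier → ℕ → Carrier
  pow q zero = 1#
  pow q (suc k) = q * pow q k

  sumR : List Carrier → Carrier
  sumR [] = 0#
  sumR (x ∷ xs) = x + sumR xs

  sumBelow : ℕ → (ℕ → Carrier) → Carrier
  sumBelow zero f = 0#
  sumBelow (suc m) f = sumBelow m f + f m

  II : Carrier → ℕ → Carrier
  II q n = sumR (map (λ ι → pow q (inv ι)) (Inv321 n))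

  IF : Carrier → ℕ → Carrier
  IF q n = sumR (map (λ ι → pow q (inv ι)) (FInv321 n))

module Submission where

-- A 321-avoiding involution ι of [n] is either fixed-point-free or has a
-- smallest fixed point m < n.  In the latter case ι maps [0, m) into itself
-- (if x < m had ι(x) > m, then ι(x) m x would be an occurrence of 321), so ι
-- is the direct sum a ⊕ 1 ⊕ b of a fixed-point-free 321-avoiding involution a
-- of [m] and a 321-avoiding involution b of [n-m-1]; conversely every such
-- a ⊕ 1 ⊕ b has first fixed point m, and inv(a ⊕ 1 ⊕ b) = inv a + inv b.
-- Summing q^inv gives II_n = IF_n + Σ_{m<n} IF_m II_{n-m-1}, and as
-- fixed-point-free involutions live only on sets of even size, the odd m drop.

open import Defs
open import Level using (Level)
open import Data.Nat using (ℕ; zero; suc; _<_; _≤_; z≤n; s≤s; _∸_; ⌈_/2⌉; ⌊_/2⌋)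
  renaming (_+_ to _+ℕ_; _*_ to _*ℕ_)
import Data.Nat.Properties as ℕP
open import Data.Fin as F using (Fin; zero; suc; toℕ; _↑ˡ_; _↑ʳ_; splitAt)
import Data.Fin.Properties as FP
open import Data.Vec using (Vec; []; _∷_; lookup; tabulate)
import Data.Vec as V
import Data.Vec.Properties as VP
open import Data.List using (List; []; _∷_; map; filterᵇ; allFin; concatMap; _++_)
import Data.List.Properties as LP
import Data.List.Relation.Unary.All as All
import Data.List.Relation.Unary.All.Properties as All
import Data.List.Relation.Unary.Any as Any
import Data.List.Relation.Unary.Any.Properties as Any
open import Data.Bool using (Bool; true; false; _∧_; _∨_; not; if_then_else_)
import Data.Bool.Properties as BP
open import Data.Product using (_×_; ∃; ∃₂; _,_; proj₁; proj₂)
open import Data.Sum using (_⊎_; inj₁; inj₂; [_,_]′)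
open import Data.Empty using (⊥; ⊥-elim)
open import Relation.Nullary using (¬_; Dec; yes; no)
open import Relation.Nullary.Decidable using (⌊_⌋)
open import Relation.Binary.Definitions using (tri<; tri≈; tri>)
open import Relation.Binary.PropositionalEquality
  using (_≡_; refl; sym; trans; cong; cong₂; subst; subst₂; module ≡-Reasoning)
open import Function.Bundles using (_⇔_; mk⇔; Equivalence)
open import Function.Properties.Equivalence using () renaming (trans to ⇔-trans)
open import Algebra.Bundles using (CommutativeSemiring; CommutativeMonoid)

Decides : Bool → Set → Set
Decides b P = (b ≡ true) ⇔ P

true≢false : ∀ {b : Bool} → b ≡ true → b ≡ false → ⊥
true≢false refl ()

not-decides : ∀ {a} {P : Set} → Decides a P → Decides (not a) (¬ P)
not-decides {true}  dP = mk⇔ (λ ()) (λ ¬p → ⊥-elim (¬p (Equivalence.to dP refl)))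
not-decides {false} dP = mk⇔ (λ _ p → true≢false (Equivalence.from dP p) refl) (λ _ → refl)

module _ {P Q : Set} where
  open Equivalence

  ∧-decides : ∀ {a b} → Decides a P → Decides b Q → Decides (a ∧ b) (P × Q)
  ∧-decides {true}  dP dQ = mk⇔ (λ e → to dP refl , to dQ e) (λ pq → from dQ (proj₂ pq))
  ∧-decides {false} dP dQ = mk⇔ (λ ()) (λ pq → from dP (proj₁ pq))

  ∨-decides : ∀ {a b} → Decides a P → Decides b Q → Decides (a ∨ b) (P ⊎ Q)
  ∨-decides {true}  dP dQ = mk⇔ (λ _ → inj₁ (to dP refl)) (λ _ → refl)
  ∨-decides {false} dP dQ =
    mk⇔ (λ e → inj₂ (to dQ e)) [ (λ p → ⊥-elim (true≢false (from dP p) refl)) , from dQ ]′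

  decides-unique : ∀ {a b} → Decides a P → Decides b Q → P ⇔ Q → a ≡ b
  decides-unique {true}  {true}  dP dQ PQ = refl
  decides-unique {false} {false} dP dQ PQ = refl
  decides-unique {true}  {false} dP dQ PQ = sym (from dQ (to PQ (to dP refl)))
  decides-unique {false} {true}  dP dQ PQ = from dP (from PQ (to dQ refl))

⌊⌋-decides : ∀ {P : Set} (d : Dec P) → Decides ⌊ d ⌋ P
⌊⌋-decides (yes p) = mk⇔ (λ _ → p) (λ _ → refl)
⌊⌋-decides (no ¬p) = mk⇔ (λ ()) (λ p → ⊥-elim (¬p p))

module _ {A : Set} {p : A → Bool} {P : A → Set} (d : ∀ x → Decides (p x) (P x)) where
  open Equivalence

  allL-decides : ∀ xs → Decides (allL p xs) (All.All P xs)
  allL-decides []       = mk⇔ (λ _ → All.[]) (λ _ → refl)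
  allL-decides (x ∷ xs) = ⇔-trans (∧-decides (d x) (allL-decides xs))
    (mk⇔ (λ pq → proj₁ pq All.∷ proj₂ pq) (λ { (px All.∷ pxs) → px , pxs }))

  anyL-decides : ∀ xs → Decides (anyL p xs) (Any.Any P xs)
  anyL-decides []       = mk⇔ (λ ()) (λ ())
  anyL-decides (x ∷ xs) = ⇔-trans (∨-decides (d x) (anyL-decides xs))
    (mk⇔ [ Any.here , Any.there ]′ (λ { (Any.here px) → inj₁ px ; (Any.there q) → inj₂ q }))

module _ {n : ℕ} {p : Fin n → Bool} {P : Fin n → Set} (d : ∀ i → Decides (p i) (P i)) where

  allFin-decides : Decides (allL p (allFin n)) (∀ i → P i)
  allFin-decides = ⇔-trans (allL-decides d (allFin n)) (mk⇔ All.tabulate⁻ All.tabulate⁺)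

  anyFin-decides : Decides (anyL p (allFin n)) (∃ λ i → P i)
  anyFin-decides = ⇔-trans (anyL-decides d (allFin n))
    (mk⇔ Any.tabulate⁻ (λ ip → Any.tabulate⁺ (proj₁ ip) (proj₂ ip)))

eqᵇ-decides : ∀ {n} (i j : Fin n) → Decides (eqᵇ i j) (i ≡ j)
eqᵇ-decides i j = ⌊⌋-decides (i F.≟ j)

ltᵇ-decides : ∀ {n} (i j : Fin n) → Decides (ltᵇ i j) (i F.< j)
ltᵇ-decides i j = ⌊⌋-decides (i F.<? j)

IsInvolution : ∀ {n} → Word n → Set
IsInvolution ι = ∀ i → lookup ι (lookup ι i) ≡ i

IsFixedPointFree : ∀ {n} → Word n → Set
IsFixedPointFree ι = ∀ i → ¬ (lookup ι i ≡ i)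

Occurs321 : ∀ {n} → Word n → Fin n → Fin n → Fin n → Set
Occurs321 σ i j k = i F.< j × j F.< k × lookup σ j F.< lookup σ i × lookup σ k F.< lookup σ j

Has321 : ∀ {n} → Word n → Set
Has321 σ = ∃ λ i → ∃ λ j → ∃ λ k → Occurs321 σ i j k

isInvolution-decides : ∀ {n} (ι : Word n) → Decides (isInvolution ι) (IsInvolution ι)
isInvolution-decides ι = allFin-decides (λ i → eqᵇ-decides (lookup ι (lookup ι i)) i)

isFixedPointFree-decides : ∀ {n} (ι : Word n) → Decides (isFixedPointFree ι) (IsFixedPointFree ι)
isFixedPointFree-decides ι = allFin-decides (λ i → not-decides (eqᵇ-decides (lookup ι i) i))

contains321-decides : ∀ {n} (σ : Word n) → Decides (contains321 σ) (Has321 σ)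
contains321-decides σ = anyFin-decides λ i → anyFin-decides λ j → anyFin-decides λ k →
  ∧-decides (ltᵇ-decides i j) (∧-decides (ltᵇ-decides j k)
    (∧-decides (ltᵇ-decides (lookup σ j) (lookup σ i)) (ltᵇ-decides (lookup σ k) (lookup σ j))))

avoids321-decides : ∀ {n} (σ : Word n) → Decides (avoids321 σ) (¬ Has321 σ)
avoids321-decides σ = not-decides (contains321-decides σ)

eqV : ∀ {n m} → Vec (Fin n) m → Vec (Fin n) m → Bool
eqV []       []       = true
eqV (x ∷ xs) (y ∷ ys) = eqᵇ x y ∧ eqV xs ys

eqV-decides : ∀ {n m} (v w : Vec (Fin n) m) → Decides (eqV v w) (v ≡ w)
eqV-decides []       []       = mk⇔ (λ _ → refl) (λ _ → refl)
eqV-decides (x ∷ xs) (y ∷ ys) = ⇔-trans (∧-decides (eqᵇ-decides x y) (eqV-decides xs ys))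
  (mk⇔ (λ e → cong₂ _∷_ (proj₁ e) (proj₂ e)) (λ e → VP.∷-injectiveˡ e , VP.∷-injectiveʳ e))

eqV-sym : ∀ {n m} (v w : Vec (Fin n) m) → eqV v w ≡ eqV w v
eqV-sym v w = decides-unique (eqV-decides v w) (eqV-decides w v) (mk⇔ sym sym)

eqᵇ-suc : ∀ {n} (x y : Fin n) → eqᵇ (suc x) (suc y) ≡ eqᵇ x y
eqᵇ-suc x y = decides-unique (eqᵇ-decides (suc x) (suc y)) (eqᵇ-decides x y)
  (mk⇔ FP.suc-injective (cong suc))

anyBelow : (ℕ → Bool) → ℕ → Bool
anyBelow g zero    = false
anyBelow g (suc n) = anyBelow g n ∨ g n

data EvenOdd : ℕ → Set where
  even : ∀ k → EvenOdd (k +ℕ k)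
  odd  : ∀ k → EvenOdd (suc (k +ℕ k))

evenOdd : ∀ n → EvenOdd n
evenOdd zero = even 0
evenOdd (suc n) with evenOdd n
... | even k = odd k
... | odd k  = subst EvenOdd (cong suc (ℕP.+-suc k k)) (even (suc k))

module Sums {c ℓ : Level} (R : CommutativeSemiring c ℓ) where
  open CommutativeSemiring R hiding (zero)
    renaming (refl to ≈-refl; sym to ≈-sym; trans to ≈-trans; reflexive to ≈-reflexive)
  open GF R
  open import Relation.Binary.Reasoning.Setoid (CommutativeSemiring.setoid R)
  open import Algebra.Properties.CommutativeSemigroup +-commutativeSemigroup using (interchange)

  ∑ : {A : Set} → List A → (A → Carrier) → Carrier
  ∑ []       f = 0#
  ∑ (x ∷ xs) f = f x + ∑ xs f

  syntax ∑ xs (λ x → e) = ∑[ x ∈ xs ] e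

  when : Bool → Carrier → Carrier
  when b v = if b then v else 0#

  when-∧ : ∀ a b v → when (a ∧ b) v ≡ when a (when b v)
  when-∧ true  b v = refl
  when-∧ false b v = refl

  when-cong : ∀ b {u v} → u ≈ v → when b u ≈ when b v
  when-cong true  e = e
  when-cong false e = ≈-refl

  when-0# : ∀ b → when b 0# ≈ 0#
  when-0# true  = ≈-refl
  when-0# false = ≈-refl

  when-* : ∀ a b u v → when (a ∧ b) (u * v) ≈ when a u * when b v
  when-* true  true  u v = ≈-refl
  when-* true  false u v = ≈-sym (zeroʳ u)
  when-* false b     u v = ≈-sym (zeroˡ _)

  when-split : ∀ b v → v ≈ when (not b) v + when b v
  when-split true  v = ≈-sym (+-identityˡ v)
  when-split false v = ≈-sym (+-identityʳ v)

  when-+ : ∀ b u v → when b (u + v) ≈ when b u + when b v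
  when-+ true  u v = ≈-refl
  when-+ false u v = ≈-sym (+-identityˡ 0#)

  ∑-cong : {A : Set} (xs : List A) {f g : A → Carrier} → (∀ x → f x ≈ g x) → ∑ xs f ≈ ∑ xs g
  ∑-cong []       e = ≈-refl
  ∑-cong (x ∷ xs) e = +-cong (e x) (∑-cong xs e)

  ∑-vanish : {A : Set} (xs : List A) {f : A → Carrier} → (∀ x → f x ≈ 0#) → ∑ xs f ≈ 0#
  ∑-vanish []       e = ≈-refl
  ∑-vanish (x ∷ xs) e = ≈-trans (+-cong (e x) (∑-vanish xs e)) (+-identityˡ 0#)

  ∑-+ : {A : Set} (xs : List A) (f g : A → Carrier) →
        ∑[ x ∈ xs ] (f x + g x) ≈ ∑ xs f + ∑ xs g
  ∑-+ []       f g = ≈-sym (+-identityˡ 0#)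
  ∑-+ (x ∷ xs) f g = ≈-trans (+-congˡ (∑-+ xs f g)) (interchange (f x) (g x) (∑ xs f) (∑ xs g))

  ∑-*ˡ : {A : Set} (xs : List A) (k : Carrier) (f : A → Carrier) → k * ∑ xs f ≈ ∑[ x ∈ xs ] (k * f x)
  ∑-*ˡ []       k f = zeroʳ k
  ∑-*ˡ (x ∷ xs) k f = ≈-trans (distribˡ k _ _) (+-congˡ (∑-*ˡ xs k f))

  ∑-*ʳ : {A : Set} (xs : List A) (k : Carrier) (f : A → Carrier) → ∑ xs f * k ≈ ∑[ x ∈ xs ] (f x * k)
  ∑-*ʳ []       k f = zeroˡ k
  ∑-*ʳ (x ∷ xs) k f = ≈-trans (distribʳ k _ _) (+-congˡ (∑-*ʳ xs k f))

  ∑-when : {A : Set} (xs : List A) (b : Bool) (f : A → Carrier) →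
           ∑[ x ∈ xs ] when b (f x) ≈ when b (∑ xs f)
  ∑-when xs true  f = ≈-refl
  ∑-when xs false f = ∑-vanish xs (λ _ → ≈-refl)

  ∑-product : {A B : Set} (xs : List A) (ys : List B) (f : A → Carrier) (g : B → Carrier) →
              ∑ xs f * ∑ ys g ≈ ∑[ x ∈ xs ] ∑[ y ∈ ys ] (f x * g y)
  ∑-product xs ys f g =
    ≈-trans (∑-*ʳ xs (∑ ys g) f) (∑-cong xs (λ x → ∑-*ˡ ys (f x) g))

  ∑-swap : {A B : Set} (xs : List A) (ys : List B) (f : A → B → Carrier) →
           ∑[ x ∈ xs ] ∑[ y ∈ ys ] f x y ≈ ∑[ y ∈ ys ] ∑[ x ∈ xs ] f x y
  ∑-swap []       ys f = ≈-sym (∑-vanish ys (λ _ → ≈-refl))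
  ∑-swap (x ∷ xs) ys f =
    ≈-trans (+-congˡ (∑-swap xs ys f)) (≈-sym (∑-+ ys (f x) (λ y → ∑[ x′ ∈ xs ] f x′ y)))

  ∑-++ : {A : Set} (xs ys : List A) (f : A → Carrier) → ∑ (xs ++ ys) f ≈ ∑ xs f + ∑ ys f
  ∑-++ []       ys f = ≈-sym (+-identityˡ _)
  ∑-++ (x ∷ xs) ys f = ≈-trans (+-congˡ (∑-++ xs ys f)) (≈-sym (+-assoc _ _ _))

  ∑-map : {A B : Set} (h : A → B) (xs : List A) (f : B → Carrier) →
          ∑ (map h xs) f ≡ ∑[ x ∈ xs ] f (h x)
  ∑-map h []       f = refl
  ∑-map h (x ∷ xs) f = cong (f (h x) +_) (∑-map h xs f)

  ∑-concatMap : {A B : Set} (g : A → List B) (xs : List A) (f : B → Carrier) →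
                ∑ (concatMap g xs) f ≈ ∑[ x ∈ xs ] ∑ (g x) f
  ∑-concatMap g []       f = ≈-refl
  ∑-concatMap g (x ∷ xs) f = ≈-trans (∑-++ (g x) _ f) (+-congˡ (∑-concatMap g xs f))

  ∑-allFin-suc : ∀ {n} (f : Fin (suc n) → Carrier) →
                 ∑ (allFin (suc n)) f ≡ f zero + ∑[ i ∈ allFin n ] f (suc i)
  ∑-allFin-suc {n} f = cong (f zero +_)
    (trans (cong (λ is → ∑ is f) (sym (LP.map-tabulate (λ i → i) suc))) (∑-map suc (allFin n) f))

  ∑-allFin-+ : ∀ m s (f : Fin (m +ℕ s) → Carrier) →
               ∑ (allFin (m +ℕ s)) f ≈ ∑[ i ∈ allFin m ] f (i ↑ˡ s) + ∑[ j ∈ allFin s ] f (m ↑ʳ j)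
  ∑-allFin-+ zero    s f = ≈-sym (+-identityˡ _)
  ∑-allFin-+ (suc m) s f = begin
    ∑ (allFin (suc m +ℕ s)) f
      ≡⟨ ∑-allFin-suc f ⟩
    f zero + ∑[ i ∈ allFin (m +ℕ s) ] f (suc i)
      ≈⟨ +-congˡ (∑-allFin-+ m s (λ i → f (suc i))) ⟩
    f zero + (∑[ i ∈ allFin m ] f (suc (i ↑ˡ s)) + ∑[ j ∈ allFin s ] f (suc m ↑ʳ j))
      ≈⟨ +-assoc _ _ _ ⟨
    (f zero + ∑[ i ∈ allFin m ] f (suc (i ↑ˡ s))) + ∑[ j ∈ allFin s ] f (suc m ↑ʳ j)
      ≡⟨ cong (_+ ∑[ j ∈ allFin s ] f (suc m ↑ʳ j)) (∑-allFin-suc (λ i → f (i ↑ˡ s))) ⟨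
    ∑[ i ∈ allFin (suc m) ] f (i ↑ˡ s) + ∑[ j ∈ allFin s ] f (suc m ↑ʳ j) ∎

  ∑-allVecs-suc : ∀ n m (f : Vec (Fin n) (suc m) → Carrier) →
                  ∑ (allVecs n (suc m)) f ≈ ∑[ x ∈ allFin n ] ∑[ v ∈ allVecs n m ] f (x ∷ v)
  ∑-allVecs-suc n m f = ≈-trans (∑-concatMap (λ x → map (x ∷_) (allVecs n m)) (allFin n) f)
    (∑-cong (allFin n) (λ x → ≈-reflexive (∑-map (x ∷_) (allVecs n m) f)))

  ∑-δ-Fin : ∀ {n} (y : Fin n) (g : Fin n → Carrier) → ∑[ x ∈ allFin n ] when (eqᵇ x y) (g x) ≈ g y
  ∑-δ-Fin {suc n} zero    g = begin
    ∑[ x ∈ allFin (suc n) ] when (eqᵇ x zero) (g x)  ≡⟨ ∑-allFin-suc (λ x → when (eqᵇ x zero) (g x)) ⟩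
    g zero + ∑[ x ∈ allFin n ] 0#                    ≈⟨ +-congˡ (∑-vanish (allFin n) (λ _ → ≈-refl)) ⟩
    g zero + 0#                                      ≈⟨ +-identityʳ _ ⟩
    g zero                                           ∎
  ∑-δ-Fin {suc n} (suc y) g = begin
    ∑[ x ∈ allFin (suc n) ] when (eqᵇ x (suc y)) (g x)
      ≡⟨ ∑-allFin-suc (λ x → when (eqᵇ x (suc y)) (g x)) ⟩
    0# + ∑[ x ∈ allFin n ] when (eqᵇ (suc x) (suc y)) (g (suc x))
      ≈⟨ +-identityˡ _ ⟩
    ∑[ x ∈ allFin n ] when (eqᵇ (suc x) (suc y)) (g (suc x))
      ≈⟨ ∑-cong (allFin n) (λ x → ≈-reflexive (cong (λ b → when b (g (suc x))) (eqᵇ-suc x y))) ⟩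
    ∑[ x ∈ allFin n ] when (eqᵇ x y) (g (suc x))        ≈⟨ ∑-δ-Fin y (λ x → g (suc x)) ⟩
    g (suc y)                                           ∎

  ∑-δ-Vec : ∀ {n m} (w : Vec (Fin n) m) (g : Vec (Fin n) m → Carrier) →
            ∑[ v ∈ allVecs n m ] when (eqV v w) (g v) ≈ g w
  ∑-δ-Vec []      g = +-identityʳ _
  ∑-δ-Vec {n} {suc m} (y ∷ w) g = begin
    ∑[ v ∈ allVecs n (suc m) ] when (eqV v (y ∷ w)) (g v)
      ≈⟨ ∑-allVecs-suc n m (λ v → when (eqV v (y ∷ w)) (g v)) ⟩
    ∑[ x ∈ allFin n ] ∑[ v ∈ allVecs n m ] when (eqᵇ x y ∧ eqV v w) (g (x ∷ v))
      ≈⟨ ∑-cong (allFin n) (λ x → ≈-trans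
           (∑-cong (allVecs n m) (λ v → ≈-reflexive (when-∧ (eqᵇ x y) (eqV v w) (g (x ∷ v)))))
           (∑-when (allVecs n m) (eqᵇ x y) (λ v → when (eqV v w) (g (x ∷ v))))) ⟩
    ∑[ x ∈ allFin n ] when (eqᵇ x y) (∑[ v ∈ allVecs n m ] when (eqV v w) (g (x ∷ v)))
      ≈⟨ ∑-cong (allFin n) (λ x → when-cong (eqᵇ x y) (∑-δ-Vec w (λ v → g (x ∷ v)))) ⟩
    ∑[ x ∈ allFin n ] when (eqᵇ x y) (g (x ∷ w))
      ≈⟨ ∑-δ-Fin y (λ x → g (x ∷ w)) ⟩
    g (y ∷ w) ∎

  ∑-involution : ∀ {n} (ι : Word n) → IsInvolution ι → (f : Fin n → Carrier) →
                 ∑[ j ∈ allFin n ] f (lookup ι j) ≈ ∑ (allFin n) f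
  ∑-involution {n} ι inv f = begin
    ∑[ j ∈ allFin n ] f (lookup ι j)
      ≈⟨ ∑-cong (allFin n) (λ j → ∑-δ-Fin (lookup ι j) f) ⟨
    ∑[ j ∈ allFin n ] ∑[ i ∈ allFin n ] when (eqᵇ i (lookup ι j)) (f i)
      ≈⟨ ∑-swap (allFin n) (allFin n) _ ⟩
    ∑[ i ∈ allFin n ] ∑[ j ∈ allFin n ] when (eqᵇ i (lookup ι j)) (f i)
      ≈⟨ ∑-cong (allFin n) (λ i → ∑-cong (allFin n) (λ j →
           ≈-reflexive (cong (λ b → when b (f i)) (swap-sides i j)))) ⟩
    ∑[ i ∈ allFin n ] ∑[ j ∈ allFin n ] when (eqᵇ j (lookup ι i)) (f i)
      ≈⟨ ∑-cong (allFin n) (λ i → ∑-δ-Fin (lookup ι i) (λ _ → f i)) ⟩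
    ∑ (allFin n) f ∎
    where
    swap-sides : ∀ i j → eqᵇ i (lookup ι j) ≡ eqᵇ j (lookup ι i)
    swap-sides i j = decides-unique (eqᵇ-decides i (lookup ι j)) (eqᵇ-decides j (lookup ι i))
      (mk⇔ (λ e → trans (sym (inv j)) (cong (lookup ι) (sym e)))
           (λ e → trans (sym (inv i)) (cong (lookup ι) (sym e))))

  sumR-filter : {A : Set} (p : A → Bool) (f : A → Carrier) (xs : List A) →
                sumR (map f (filterᵇ p xs)) ≈ ∑[ x ∈ xs ] when (p x) (f x)
  sumR-filter p f []       = ≈-refl
  sumR-filter p f (x ∷ xs) with p x
  ... | true  = +-congˡ (sumR-filter p f xs)
  ... | false = ≈-trans (sumR-filter p f xs) (≈-sym (+-identityˡ _))

  module _ {n₁ n₂ n : ℕ} (φ : Word n₁ → Word n₂ → Word n)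
           (φ-injective : ∀ {a a′ b b′} → φ a b ≡ φ a′ b′ → a ≡ a′ × b ≡ b′)
           (P : Word n → Bool) (φ-onto : ∀ ι → P ι ≡ true → ∃₂ λ a b → φ a b ≡ ι) where

    private
      As = allVecs n₁ n₁
      Bs = allVecs n₂ n₂
      Ws = allVecs n n

    -- Each word satisfying P is hit by exactly one pair.
    fibre : (F : Word n → Carrier) → (∀ ι → P ι ≡ false → F ι ≈ 0#) → ∀ ι →
            F ι ≈ ∑[ a ∈ As ] ∑[ b ∈ Bs ] when (eqV (φ a b) ι) (F ι)
    fibre F F-outside ι with P ι in Pι
    ... | false = ≈-trans (F-outside ι Pι)
      (≈-sym (∑-vanish As (λ a → ∑-vanish Bs (λ b →
        ≈-trans (when-cong (eqV (φ a b) ι) (F-outside ι Pι)) (when-0# (eqV (φ a b) ι))))))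
    ... | true with φ-onto ι Pι
    ...   | a₀ , b₀ , φab≡ι = ≈-sym (begin
      ∑[ a ∈ As ] ∑[ b ∈ Bs ] when (eqV (φ a b) ι) (F ι)
        ≈⟨ ∑-cong As (λ a → ∑-cong Bs (λ b → ≈-reflexive
             (trans (cong (λ t → when t (F ι)) (eqV-φ a b)) (when-∧ (eqV a a₀) (eqV b b₀) (F ι))))) ⟩
      ∑[ a ∈ As ] ∑[ b ∈ Bs ] when (eqV a a₀) (when (eqV b b₀) (F ι))
        ≈⟨ ∑-cong As (λ a → ∑-when Bs (eqV a a₀) _) ⟩
      ∑[ a ∈ As ] when (eqV a a₀) (∑[ b ∈ Bs ] when (eqV b b₀) (F ι))
        ≈⟨ ∑-cong As (λ a → when-cong (eqV a a₀) (∑-δ-Vec b₀ (λ _ → F ι))) ⟩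
      ∑[ a ∈ As ] when (eqV a a₀) (F ι)
        ≈⟨ ∑-δ-Vec a₀ (λ _ → F ι) ⟩
      F ι ∎)
      where
      eqV-φ : ∀ a b → eqV (φ a b) ι ≡ eqV a a₀ ∧ eqV b b₀
      eqV-φ a b = decides-unique (eqV-decides (φ a b) ι)
        (∧-decides (eqV-decides a a₀) (eqV-decides b b₀))
        (mk⇔ (λ e → φ-injective (trans e (sym φab≡ι)))
             (λ e → trans (cong₂ φ (proj₁ e) (proj₂ e)) φab≡ι))

    ∑-change-of-variables : (f : Word n → Carrier) →
      ∑[ ι ∈ Ws ] when (P ι) (f ι) ≈ ∑[ a ∈ As ] ∑[ b ∈ Bs ] when (P (φ a b)) (f (φ a b))
    ∑-change-of-variables f = begin
      ∑[ ι ∈ Ws ] F ι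
        ≈⟨ ∑-cong Ws (fibre F (λ ι Pι → ≈-reflexive (cong (λ t → when t (f ι)) Pι))) ⟩
      ∑[ ι ∈ Ws ] ∑[ a ∈ As ] ∑[ b ∈ Bs ] when (eqV (φ a b) ι) (F ι)
        ≈⟨ ∑-swap Ws As _ ⟩
      ∑[ a ∈ As ] ∑[ ι ∈ Ws ] ∑[ b ∈ Bs ] when (eqV (φ a b) ι) (F ι)
        ≈⟨ ∑-cong As (λ a → ∑-swap Ws Bs _) ⟩
      ∑[ a ∈ As ] ∑[ b ∈ Bs ] ∑[ ι ∈ Ws ] when (eqV (φ a b) ι) (F ι)
        ≈⟨ ∑-cong As (λ a → ∑-cong Bs (λ b → ≈-trans
             (∑-cong Ws (λ ι → ≈-reflexive (cong (λ t → when t (F ι)) (eqV-sym (φ a b) ι))))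
             (∑-δ-Vec (φ a b) F))) ⟩
      ∑[ a ∈ As ] ∑[ b ∈ Bs ] F (φ a b) ∎
      where
      F : Word n → Carrier
      F ι = when (P ι) (f ι)

  sumBelow-cong : ∀ n {f g : ℕ → Carrier} → (∀ k → k < n → f k ≈ g k) → sumBelow n f ≈ sumBelow n g
  sumBelow-cong zero    e = ≈-refl
  sumBelow-cong (suc n) e =
    +-cong (sumBelow-cong n (λ k k<n → e k (ℕP.m<n⇒m<1+n k<n))) (e n (ℕP.n<1+n n))

  sumBelow-when : ∀ b n (f : ℕ → Carrier) → sumBelow n (λ k → when b (f k)) ≈ when b (sumBelow n f)
  sumBelow-when true  n       f = ≈-refl
  sumBelow-when false zero    f = ≈-refl
  sumBelow-when false (suc n) f = ≈-trans (+-identityʳ _) (sumBelow-when false n f)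

  ∑-sumBelow : {A : Set} (xs : List A) (n : ℕ) (f : A → ℕ → Carrier) →
               ∑[ x ∈ xs ] sumBelow n (f x) ≈ sumBelow n (λ k → ∑[ x ∈ xs ] f x k)
  ∑-sumBelow xs zero    f = ∑-vanish xs (λ _ → ≈-refl)
  ∑-sumBelow xs (suc n) f = ≈-trans (∑-+ xs _ _) (+-congʳ (∑-sumBelow xs n f))

  sumBelow-first : (g : ℕ → Bool) (v : Carrier) (n : ℕ) →
                   sumBelow n (λ k → when (g k ∧ not (anyBelow g k)) v) ≈ when (anyBelow g n) v
  sumBelow-first g v zero    = ≈-refl
  sumBelow-first g v (suc n) = ≈-trans (+-congʳ (sumBelow-first g v n)) (next (anyBelow g n) (g n))
    where
    next : ∀ a b → when a v + when (b ∧ not a) v ≈ when (a ∨ b) v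
    next true  true  = +-identityʳ v
    next true  false = +-identityʳ v
    next false true  = +-identityˡ v
    next false false = +-identityˡ 0#

  module _ (h : ℕ → Carrier) (h-odd : ∀ k → h (suc (k +ℕ k)) ≈ 0#) where

    private
      h₂ : ℕ → Carrier
      h₂ j = h (2 *ℕ j)

      h-double : ∀ k → h (k +ℕ k) ≈ h₂ k
      h-double k = ≈-reflexive (cong (λ t → h (k +ℕ t)) (sym (ℕP.+-identityʳ k)))

      sumBelow-double : ∀ k → sumBelow (k +ℕ k) h ≈ sumBelow k h₂
      sumBelow-double zero    = ≈-refl
      sumBelow-double (suc k) = begin
        sumBelow (suc k +ℕ suc k) h
          ≡⟨ cong (λ t → sumBelow (suc t) h) (ℕP.+-suc k k) ⟩
        (sumBelow (k +ℕ k) h + h (k +ℕ k)) + h (suc (k +ℕ k))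
          ≈⟨ +-cong (+-cong (sumBelow-double k) (h-double k)) (h-odd k) ⟩
        (sumBelow k h₂ + h₂ k) + 0#
          ≈⟨ +-identityʳ _ ⟩
        sumBelow (suc k) h₂ ∎

    sumBelow-evens : ∀ n → sumBelow n h ≈ sumBelow ⌈ n /2⌉ h₂
    sumBelow-evens n with evenOdd n
    ... | even k = ≈-trans (sumBelow-double k)
      (≈-reflexive (cong (λ t → sumBelow t h₂) (ℕP.n≡⌈n+n/2⌉ k)))
    ... | odd k = ≈-trans (+-cong (sumBelow-double k) (h-double k))
      (≈-reflexive (cong (λ t → sumBelow (suc t) h₂) (ℕP.n≡⌊n+n/2⌋ k)))

vec-ext : ∀ {A : Set} {n} {v w : Vec A n} → (∀ i → lookup v i ≡ lookup w i) → v ≡ w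
vec-ext {v = v} {w} h =
  trans (sym (VP.tabulate∘lookup v)) (trans (VP.tabulate-cong h) (VP.tabulate∘lookup w))

module Intertwiner {m n : ℕ} {σ : Word m} {τ : Word n} (e : Fin m → Fin n)
                   (intertwines : ∀ i → lookup τ (e i) ≡ e (lookup σ i)) where

  involution-pull : (∀ {x y} → e x ≡ e y → x ≡ y) → IsInvolution τ → IsInvolution σ
  involution-pull e-injective τ² i = e-injective (begin
    e (lookup σ (lookup σ i))  ≡⟨ intertwines (lookup σ i) ⟨
    lookup τ (e (lookup σ i))  ≡⟨ cong (lookup τ) (intertwines i) ⟨
    lookup τ (lookup τ (e i))  ≡⟨ τ² (e i) ⟩
    e i                        ∎)
    where open ≡-Reasoning

  involution-push : IsInvolution σ → ∀ i → lookup τ (lookup τ (e i)) ≡ e i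
  involution-push σ² i = begin
    lookup τ (lookup τ (e i))  ≡⟨ cong (lookup τ) (intertwines i) ⟩
    lookup τ (e (lookup σ i))  ≡⟨ intertwines (lookup σ i) ⟩
    e (lookup σ (lookup σ i))  ≡⟨ cong e (σ² i) ⟩
    e i                        ∎
    where open ≡-Reasoning

  occurrence-push : (∀ {x y} → x F.< y → e x F.< e y) →
                    ∀ {i j k} → Occurs321 σ i j k → Occurs321 τ (e i) (e j) (e k)
  occurrence-push mono {i} {j} {k} (i<j , j<k , σj<σi , σk<σj) =
    mono i<j , mono j<k ,
    subst₂ F._<_ (sym (intertwines j)) (sym (intertwines i)) (mono σj<σi) ,
    subst₂ F._<_ (sym (intertwines k)) (sym (intertwines j)) (mono σk<σj)

  occurrence-pull : (∀ {x y} → e x F.< e y → x F.< y) →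
                    ∀ {i j k} → Occurs321 τ (e i) (e j) (e k) → Occurs321 σ i j k
  occurrence-pull refl< {i} {j} {k} (i<j , j<k , τj<τi , τk<τj) =
    refl< i<j , refl< j<k ,
    refl< (subst₂ F._<_ (intertwines j) (intertwines i) τj<τi) ,
    refl< (subst₂ F._<_ (intertwines k) (intertwines j) τk<τj)

_⊕_ : ∀ {m s} → Word m → Word s → Word (m +ℕ s)
_⊕_ {m} {s} a c = V.map (_↑ˡ s) a V.++ V.map (m ↑ʳ_) c

data Block (m s : ℕ) : Fin (m +ℕ s) → Set where
  inLeft  : (i : Fin m) → Block m s (i ↑ˡ s)
  inRight : (j : Fin s) → Block m s (m ↑ʳ j)

block : ∀ m s (k : Fin (m +ℕ s)) → Block m s k
block m s k with splitAt m k in eq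
... | inj₁ i = subst (Block m s) (FP.splitAt⁻¹-↑ˡ eq) (inLeft i)
... | inj₂ j = subst (Block m s) (FP.splitAt⁻¹-↑ʳ eq) (inRight j)

module _ {m s : ℕ} where

  ↑ˡ-<⇔ : ∀ {i i′ : Fin m} → i F.< i′ ⇔ i ↑ˡ s F.< i′ ↑ˡ s
  ↑ˡ-<⇔ {i} {i′} = mk⇔ (subst₂ _<_ (sym (FP.toℕ-↑ˡ i s)) (sym (FP.toℕ-↑ˡ i′ s)))
                       (subst₂ _<_ (FP.toℕ-↑ˡ i s) (FP.toℕ-↑ˡ i′ s))

  ↑ʳ-<⇔ : ∀ {j j′ : Fin s} → j F.< j′ ⇔ m ↑ʳ j F.< m ↑ʳ j′
  ↑ʳ-<⇔ {j} {j′} =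
    mk⇔ (λ j<j′ → subst₂ _<_ (sym (FP.toℕ-↑ʳ m j)) (sym (FP.toℕ-↑ʳ m j′)) (ℕP.+-monoʳ-< m j<j′))
        (λ lt → ℕP.+-cancelˡ-< m _ _ (subst₂ _<_ (FP.toℕ-↑ʳ m j) (FP.toℕ-↑ʳ m j′) lt))

  ↑ˡ<↑ʳ : (i : Fin m) (j : Fin s) → i ↑ˡ s F.< m ↑ʳ j
  ↑ˡ<↑ʳ i j = subst₂ _<_ (sym (FP.toℕ-↑ˡ i s)) (sym (FP.toℕ-↑ʳ m j))
    (ℕP.<-≤-trans (FP.toℕ<n i) (ℕP.m≤m+n m (toℕ j)))

  ↑ʳ≮↑ˡ : (i : Fin m) (j : Fin s) → ¬ (m ↑ʳ j F.< i ↑ˡ s)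
  ↑ʳ≮↑ˡ i j lt = ℕP.<-asym lt (↑ˡ<↑ʳ i j)

  ↑ˡ≢↑ʳ : (i : Fin m) (j : Fin s) → ¬ (i ↑ˡ s ≡ m ↑ʳ j)
  ↑ˡ≢↑ʳ i j eq = ℕP.<-irrefl (cong toℕ eq) (↑ˡ<↑ʳ i j)

  module _ (a : Word m) (c : Word s) where

    ⊕-lookupˡ : ∀ i → lookup (a ⊕ c) (i ↑ˡ s) ≡ lookup a i ↑ˡ s
    ⊕-lookupˡ i = trans (VP.lookup-++ˡ (V.map (_↑ˡ s) a) _ i) (VP.lookup-map i (_↑ˡ s) a)

    ⊕-lookupʳ : ∀ j → lookup (a ⊕ c) (m ↑ʳ j) ≡ m ↑ʳ lookup c j
    ⊕-lookupʳ j = trans (VP.lookup-++ʳ (V.map (_↑ˡ s) a) _ j) (VP.lookup-map j (m ↑ʳ_) c)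

    private
      module L = Intertwiner {σ = a} {τ = a ⊕ c} (_↑ˡ s) ⊕-lookupˡ
      module R = Intertwiner {σ = c} {τ = a ⊕ c} (m ↑ʳ_) ⊕-lookupʳ

    ⊕-IsInvolution : IsInvolution (a ⊕ c) ⇔ (IsInvolution a × IsInvolution c)
    ⊕-IsInvolution = mk⇔
      (λ inv → L.involution-pull (FP.↑ˡ-injective s _ _) inv , R.involution-pull (FP.↑ʳ-injective m _ _) inv)
      (λ inv k → on-block (block m s k) inv)
      where
      on-block : ∀ {k} → Block m s k → IsInvolution a × IsInvolution c →
                 lookup (a ⊕ c) (lookup (a ⊕ c) k) ≡ k
      on-block (inLeft i)  inv = L.involution-push (proj₁ inv) i
      on-block (inRight j) inv = R.involution-push (proj₂ inv) j

    -- A 321-occurrence of a ⊕ c lies inside one block: an inversion across the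
    -- blocks is impossible since the left block lies below the right one.
    ⊕-Has321 : Has321 (a ⊕ c) ⇔ (Has321 a ⊎ Has321 c)
    ⊕-Has321 = mk⇔ (λ { (i , j , k , occ) → in-blocks (block m s i) (block m s j) (block m s k) occ })
      [ (λ { (i , j , k , occ) →
               i ↑ˡ s , j ↑ˡ s , k ↑ˡ s , L.occurrence-push (Equivalence.to ↑ˡ-<⇔) occ }) ,
        (λ { (i , j , k , occ) →
               m ↑ʳ i , m ↑ʳ j , m ↑ʳ k , R.occurrence-push (Equivalence.to ↑ʳ-<⇔) occ }) ]′
      where
      in-blocks : ∀ {x y z} → Block m s x → Block m s y → Block m s z →
                  Occurs321 (a ⊕ c) x y z → Has321 a ⊎ Has321 c
      in-blocks (inLeft i) (inLeft j) (inLeft k) occ =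
        inj₁ (i , j , k , L.occurrence-pull (Equivalence.from ↑ˡ-<⇔) occ)
      in-blocks (inLeft i) (inLeft j) (inRight k) (_ , _ , _ , ck<aj) =
        ⊥-elim (↑ʳ≮↑ˡ _ _ (subst₂ F._<_ (⊕-lookupʳ k) (⊕-lookupˡ j) ck<aj))
      in-blocks (inLeft i) (inRight j) _ (_ , _ , cj<ai , _) =
        ⊥-elim (↑ʳ≮↑ˡ _ _ (subst₂ F._<_ (⊕-lookupʳ j) (⊕-lookupˡ i) cj<ai))
      in-blocks (inRight i) (inLeft j) _ (i<j , _) = ⊥-elim (↑ʳ≮↑ˡ j i i<j)
      in-blocks (inRight i) (inRight j) (inLeft k) (_ , j<k , _) = ⊥-elim (↑ʳ≮↑ˡ k j j<k)
      in-blocks (inRight i) (inRight j) (inRight k) occ =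
        inj₂ (i , j , k , R.occurrence-pull (Equivalence.from ↑ʳ-<⇔) occ)

    ⊕-isInvolution : isInvolution (a ⊕ c) ≡ isInvolution a ∧ isInvolution c
    ⊕-isInvolution = decides-unique (isInvolution-decides (a ⊕ c))
      (∧-decides (isInvolution-decides a) (isInvolution-decides c)) ⊕-IsInvolution

    ⊕-avoids321 : avoids321 (a ⊕ c) ≡ avoids321 a ∧ avoids321 c
    ⊕-avoids321 = decides-unique (avoids321-decides (a ⊕ c))
      (∧-decides (avoids321-decides a) (avoids321-decides c))
      (mk⇔ (λ ¬h → (λ h → ¬h (Equivalence.from ⊕-Has321 (inj₁ h))) ,
                   (λ h → ¬h (Equivalence.from ⊕-Has321 (inj₂ h))))
           (λ ¬h h → [ proj₁ ¬h , proj₂ ¬h ]′ (Equivalence.to ⊕-Has321 h)))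

  ⊕-injective : ∀ {a a′ : Word m} {c c′ : Word s} → a ⊕ c ≡ a′ ⊕ c′ → a ≡ a′ × c ≡ c′
  ⊕-injective {a} {a′} {c} {c′} eq =
    vec-ext (λ i → FP.↑ˡ-injective s _ _
      (trans (sym (⊕-lookupˡ a c i)) (trans (cong (λ v → lookup v (i ↑ˡ s)) eq) (⊕-lookupˡ a′ c′ i)))) ,
    vec-ext (λ j → FP.↑ʳ-injective m _ _
      (trans (sym (⊕-lookupʳ a c j)) (trans (cong (λ v → lookup v (m ↑ʳ j)) eq) (⊕-lookupʳ a′ c′ j))))

  LeftClosed : Word (m +ℕ s) → Set
  LeftClosed ι = ∀ i → ∃ λ i′ → lookup ι (i ↑ˡ s) ≡ i′ ↑ˡ s

  RightClosed : Word (m +ℕ s) → Set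
  RightClosed ι = ∀ j → ∃ λ j′ → lookup ι (m ↑ʳ j) ≡ m ↑ʳ j′

  ⊕-split : (ι : Word (m +ℕ s)) → LeftClosed ι → RightClosed ι → ∃₂ λ a c → a ⊕ c ≡ ι
  ⊕-split ι left right = a , c , vec-ext (λ k → on-block (block m s k))
    where
    a = tabulate (λ i → proj₁ (left i))
    c = tabulate (λ j → proj₁ (right j))
    on-block : ∀ {k} → Block m s k → lookup (a ⊕ c) k ≡ lookup ι k
    on-block (inLeft i) = trans (⊕-lookupˡ a c i)
      (trans (cong (_↑ˡ s) (VP.lookup∘tabulate _ i)) (sym (proj₂ (left i))))
    on-block (inRight j) = trans (⊕-lookupʳ a c j)
      (trans (cong (m ↑ʳ_) (VP.lookup∘tabulate _ j)) (sym (proj₂ (right j))))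

  -- An involution mapping the left block into itself also maps the right
  -- block into itself: a right position sent to the left would be the image
  -- of a left position.
  involution-rightClosed : (ι : Word (m +ℕ s)) → IsInvolution ι → LeftClosed ι → RightClosed ι
  involution-rightClosed ι inv left j with lookup ι (m ↑ʳ j) in eq
  ... | y with block m s y
  ...   | inRight j′ = j′ , refl
  ...   | inLeft i = ⊥-elim (↑ˡ≢↑ʳ (proj₁ (left i)) j (begin
    proj₁ (left i) ↑ˡ s      ≡⟨ proj₂ (left i) ⟨
    lookup ι (i ↑ˡ s)        ≡⟨ cong (lookup ι) eq ⟨
    lookup ι (lookup ι (m ↑ʳ j)) ≡⟨ inv (m ↑ʳ j) ⟩
    m ↑ʳ j                   ∎))
    where open ≡-Reasoning

decides-false : ∀ {b P} → Decides b P → ¬ P → b ≡ false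
decides-false {false} d ¬p = refl
decides-false {true}  d ¬p = ⊥-elim (¬p (Equivalence.to d refl))

inverted : ∀ {n} → Word n → Fin n → Fin n → Bool
inverted σ i j = ltᵇ i j ∧ ltᵇ (lookup σ j) (lookup σ i)

inverted-along : ∀ {m n} {σ : Word m} {τ : Word n} (e : Fin m → Fin n) →
                 (∀ i → lookup τ (e i) ≡ e (lookup σ i)) →
                 (∀ {x y} → x F.< y ⇔ e x F.< e y) →
                 ∀ i j → inverted τ (e i) (e j) ≡ inverted σ i j
inverted-along {σ = σ} {τ} e intertwines embedding i j = cong₂ _∧_ (ltᵇ-along i j)
  (trans (cong₂ ltᵇ (intertwines j) (intertwines i)) (ltᵇ-along (lookup σ j) (lookup σ i)))
  where
  ltᵇ-along : ∀ x y → ltᵇ (e x) (e y) ≡ ltᵇ x y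
  ltᵇ-along x y = decides-unique (ltᵇ-decides (e x) (e y)) (ltᵇ-decides x y)
    (mk⇔ (Equivalence.from embedding) (Equivalence.to embedding))

-- inv is additive on direct sums: there are no inversions across the blocks.
module Inversions where
  open Sums ℕP.+-*-commutativeSemiring
  open ≡-Reasoning

  inv-as-∑ : ∀ {n} (σ : Word n) → inv σ ≡ ∑[ i ∈ allFin n ] ∑[ j ∈ allFin n ] when (inverted σ i j) 1
  inv-as-∑ {n} σ = trans (sumℕ-map (allFin n) _) (∑-cong (allFin n) (λ i → countL-as-∑ (allFin n)))
    where
    sumℕ-map : {A : Set} (xs : List A) (f : A → ℕ) → sumℕ (map f xs) ≡ ∑ xs f
    sumℕ-map []       f = refl
    sumℕ-map (x ∷ xs) f = cong (f x +ℕ_) (sumℕ-map xs f)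
    countL-as-∑ : ∀ {i} (xs : List (Fin n)) → countL (inverted σ i) xs ≡ ∑[ j ∈ xs ] when (inverted σ i j) 1
    countL-as-∑ []                    = refl
    countL-as-∑ {i} (j ∷ xs) with inverted σ i j
    ... | true  = cong suc (countL-as-∑ xs)
    ... | false = countL-as-∑ xs

  module _ {m s : ℕ} (a : Word m) (c : Word s) where

    left-row : ∀ i → ∑[ y ∈ allFin (m +ℕ s) ] when (inverted (a ⊕ c) (i ↑ˡ s) y) 1
                   ≡ ∑[ i′ ∈ allFin m ] when (inverted a i i′) 1
    left-row i = begin
      ∑[ y ∈ allFin (m +ℕ s) ] when (inverted (a ⊕ c) (i ↑ˡ s) y) 1
        ≡⟨ ∑-allFin-+ m s _ ⟩
      ∑[ i′ ∈ allFin m ] when (inverted (a ⊕ c) (i ↑ˡ s) (i′ ↑ˡ s)) 1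
        +ℕ ∑[ j ∈ allFin s ] when (inverted (a ⊕ c) (i ↑ˡ s) (m ↑ʳ j)) 1
        ≡⟨ cong₂ _+ℕ_
             (∑-cong (allFin m) (λ i′ → cong (λ b → when b 1)
               (inverted-along {σ = a} {τ = a ⊕ c} (_↑ˡ s) (⊕-lookupˡ a c) ↑ˡ-<⇔ i i′)))
             (∑-vanish (allFin s) (λ j → cong (λ b → when b 1) (no-cross j))) ⟩
      ∑[ i′ ∈ allFin m ] when (inverted a i i′) 1 +ℕ 0
        ≡⟨ ℕP.+-identityʳ _ ⟩
      ∑[ i′ ∈ allFin m ] when (inverted a i i′) 1 ∎
      where
      no-cross : ∀ j → inverted (a ⊕ c) (i ↑ˡ s) (m ↑ʳ j) ≡ false
      no-cross j = trans (cong (ltᵇ (i ↑ˡ s) (m ↑ʳ j) ∧_)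
        (decides-false (ltᵇ-decides _ _) (λ lt → ↑ʳ≮↑ˡ (lookup a i) (lookup c j)
          (subst₂ F._<_ (⊕-lookupʳ a c j) (⊕-lookupˡ a c i) lt))))
        (BP.∧-zeroʳ _)

    right-row : ∀ j → ∑[ y ∈ allFin (m +ℕ s) ] when (inverted (a ⊕ c) (m ↑ʳ j) y) 1
                    ≡ ∑[ j′ ∈ allFin s ] when (inverted c j j′) 1
    right-row j = begin
      ∑[ y ∈ allFin (m +ℕ s) ] when (inverted (a ⊕ c) (m ↑ʳ j) y) 1
        ≡⟨ ∑-allFin-+ m s _ ⟩
      ∑[ i ∈ allFin m ] when (inverted (a ⊕ c) (m ↑ʳ j) (i ↑ˡ s)) 1
        +ℕ ∑[ j′ ∈ allFin s ] when (inverted (a ⊕ c) (m ↑ʳ j) (m ↑ʳ j′)) 1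
        ≡⟨ cong₂ _+ℕ_
             (∑-vanish (allFin m) (λ i → cong (λ b → when b 1) (no-cross i)))
             (∑-cong (allFin s) (λ j′ → cong (λ b → when b 1)
               (inverted-along {σ = c} {τ = a ⊕ c} (m ↑ʳ_) (⊕-lookupʳ a c) ↑ʳ-<⇔ j j′))) ⟩
      ∑[ j′ ∈ allFin s ] when (inverted c j j′) 1 ∎
      where
      no-cross : ∀ i → inverted (a ⊕ c) (m ↑ʳ j) (i ↑ˡ s) ≡ false
      no-cross i = cong (_∧ ltᵇ (lookup (a ⊕ c) (i ↑ˡ s)) (lookup (a ⊕ c) (m ↑ʳ j)))
        (decides-false (ltᵇ-decides _ _) (↑ʳ≮↑ˡ i j))

    inv-⊕ : inv (a ⊕ c) ≡ inv a +ℕ inv c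
    inv-⊕ = begin
      inv (a ⊕ c)
        ≡⟨ inv-as-∑ (a ⊕ c) ⟩
      ∑[ x ∈ allFin (m +ℕ s) ] ∑[ y ∈ allFin (m +ℕ s) ] when (inverted (a ⊕ c) x y) 1
        ≡⟨ ∑-allFin-+ m s _ ⟩
      ∑[ i ∈ allFin m ] ∑[ y ∈ allFin (m +ℕ s) ] when (inverted (a ⊕ c) (i ↑ˡ s) y) 1
        +ℕ ∑[ j ∈ allFin s ] ∑[ y ∈ allFin (m +ℕ s) ] when (inverted (a ⊕ c) (m ↑ʳ j) y) 1
        ≡⟨ cong₂ _+ℕ_ (∑-cong (allFin m) left-row) (∑-cong (allFin s) right-row) ⟩
      ∑[ i ∈ allFin m ] ∑[ i′ ∈ allFin m ] when (inverted a i i′) 1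
        +ℕ ∑[ j ∈ allFin s ] ∑[ j′ ∈ allFin s ] when (inverted c j j′) 1
        ≡⟨ cong₂ _+ℕ_ (inv-as-∑ a) (inv-as-∑ c) ⟨
      inv a +ℕ inv c ∎

-- k is a fixed point of ι.  Fixed points are indexed by natural numbers so
-- that the first one can serve as a block size.
fixedAt : ∀ {n} → Word n → ℕ → Bool
fixedAt {n} ι k = anyL (λ i → ⌊ toℕ i ℕP.≟ k ⌋ ∧ eqᵇ (lookup ι i) i) (allFin n)

FixedAt : ∀ {n} → Word n → ℕ → Set
FixedAt ι k = ∃ λ i → toℕ i ≡ k × lookup ι i ≡ i

fixedAt-decides : ∀ {n} (ι : Word n) k → Decides (fixedAt ι k) (FixedAt ι k)
fixedAt-decides ι k = anyFin-decides (λ i → ∧-decides (⌊⌋-decides (toℕ i ℕP.≟ k)) (eqᵇ-decides _ _))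

anyBelow-decides : ∀ {P : ℕ → Set} (g : ℕ → Bool) → (∀ k → Decides (g k) (P k)) →
                   ∀ n → Decides (anyBelow g n) (∃ λ k → k < n × P k)
anyBelow-decides g d zero    = mk⇔ (λ ()) (λ { (k , () , _) })
anyBelow-decides g d (suc n) = ⇔-trans (∨-decides (anyBelow-decides g d n) (d n)) (mk⇔
  [ (λ { (k , k<n , p) → k , ℕP.m<n⇒m<1+n k<n , p }) , (λ p → n , ℕP.n<1+n n , p) ]′
  (λ { (k , k<1+n , p) → case-< k n (ℕP.m≤n⇒m<n∨m≡n (ℕP.≤-pred k<1+n)) p }))
  where
  case-< : ∀ {P : ℕ → Set} k n → k < n ⊎ k ≡ n → P k → (∃ λ k → k < n × P k) ⊎ P n
  case-< k n (inj₁ k<n) p = inj₁ (k , k<n , p)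
  case-< k n (inj₂ refl) p = inj₂ p

isFixedPointFree-anyBelow : ∀ {n} (ι : Word n) → isFixedPointFree ι ≡ not (anyBelow (fixedAt ι) n)
isFixedPointFree-anyBelow {n} ι = decides-unique (isFixedPointFree-decides ι)
  (not-decides (anyBelow-decides (fixedAt ι) (fixedAt-decides ι) n))
  (mk⇔ (λ { fpf (k , _ , i , _ , fix) → fpf i fix })
       (λ none i fix → none (toℕ i , FP.toℕ<n i , i , refl , fix)))

firstFixedAt : ∀ {n} → Word n → ℕ → Bool
firstFixedAt ι m = fixedAt ι m ∧ not (anyBelow (fixedAt ι) m)

involution-injective : ∀ {n} {ι : Word n} → IsInvolution ι → ∀ {x y} → lookup ι x ≡ lookup ι y → x ≡ y
involution-injective {ι = ι} inv {x} {y} eq = trans (sym (inv x)) (trans (cong (lookup ι) eq) (inv y))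

one : Word 1
one = zero ∷ []

word1 : (v : Word 1) → v ≡ one
word1 (zero ∷ []) = refl

pivot : ∀ m r → Fin (m +ℕ suc r)
pivot m r = m ↑ʳ zero

toℕ-pivot : ∀ m r → toℕ (pivot m r) ≡ m
toℕ-pivot m r = trans (FP.toℕ-↑ʳ m (zero {r})) (ℕP.+-identityʳ m)

module _ {m r : ℕ} where

  firstFixedAt-⊕ : (a : Word m) (b : Word r) → firstFixedAt (a ⊕ (one ⊕ b)) m ≡ isFixedPointFree a
  firstFixedAt-⊕ a b = decides-unique
    (∧-decides (fixedAt-decides ι m) (not-decides (anyBelow-decides (fixedAt ι) (fixedAt-decides ι) m)))
    (isFixedPointFree-decides a)
    (mk⇔ (λ { (_ , none) i fix → none (toℕ i , FP.toℕ<n i , i ↑ˡ suc r , FP.toℕ-↑ˡ i (suc r) ,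
                                         trans (⊕-lookupˡ a (one ⊕ b) i) (cong (_↑ˡ suc r) fix)) })
         (λ fpf → (pivot m r , toℕ-pivot m r , pivot-fixed) ,
                  λ { (k , k<m , x , x≡k , fix) →
                        not-left fpf (block m (suc r) x) (subst (_< m) (sym x≡k) k<m) fix }))
    where
    ι = a ⊕ (one ⊕ b)
    pivot-fixed : lookup ι (pivot m r) ≡ pivot m r
    pivot-fixed = trans (⊕-lookupʳ a (one ⊕ b) zero) (cong (m ↑ʳ_) (⊕-lookupˡ one b zero))
    not-left : IsFixedPointFree a → ∀ {x} → Block m (suc r) x → toℕ x < m → ¬ (lookup ι x ≡ x)
    not-left fpf (inLeft i) _ fix =
      fpf i (FP.↑ˡ-injective (suc r) _ _ (trans (sym (⊕-lookupˡ a (one ⊕ b) i)) fix))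
    not-left fpf (inRight j) x<m _ =
      ℕP.<⇒≱ x<m (subst (m ≤_) (sym (FP.toℕ-↑ʳ m j)) (ℕP.m≤m+n m (toℕ j)))

  -- A 321-avoiding involution maps the positions left of a fixed point m into
  -- themselves: if x < m had ι(x) > m, then ι(x) m x would be an occurrence of 321.
  fixed-point-leftClosed : (ι : Word (m +ℕ suc r)) → IsInvolution ι → ¬ Has321 ι →
                           lookup ι (pivot m r) ≡ pivot m r → LeftClosed ι
  fixed-point-leftClosed ι inv avoid fix i with lookup ι (i ↑ˡ suc r) in eq
  ... | y with block m (suc r) y
  ...   | inLeft i′     = i′ , refl
  ...   | inRight zero    = ⊥-elim (↑ˡ≢↑ʳ i zero (involution-injective {ι = ι} inv (trans eq (sym fix))))
  ...   | inRight (suc j) = ⊥-elim (avoid (i ↑ˡ suc r , pivot m r , m ↑ʳ suc j ,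
      ↑ˡ<↑ʳ i zero , pivot<y , subst₂ F._<_ (sym fix) (sym eq) pivot<y ,
      subst₂ F._<_ (sym (trans (cong (lookup ι) (sym eq)) (inv _))) (sym fix) (↑ˡ<↑ʳ i zero)))
    where
    pivot<y : pivot m r F.< m ↑ʳ suc j
    pivot<y = Equivalence.to ↑ʳ-<⇔ (s≤s z≤n)

  fixed-point-decomposition : (ι : Word (m +ℕ suc r)) → IsInvolution ι → ¬ Has321 ι →
                              lookup ι (pivot m r) ≡ pivot m r → ∃₂ λ a b → a ⊕ (one ⊕ b) ≡ ι
  fixed-point-decomposition ι inv avoid fix with
    ⊕-split ι (fixed-point-leftClosed ι inv avoid fix)
              (involution-rightClosed ι inv (fixed-point-leftClosed ι inv avoid fix))
  ... | a , c , a⊕c≡ι with ⊕-split c c-leftClosed (involution-rightClosed c c-involution c-leftClosed)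
    where
    c-involution : IsInvolution c
    c-involution = proj₂ (Equivalence.to (⊕-IsInvolution a c) (subst IsInvolution (sym a⊕c≡ι) inv))
    c-leftClosed : LeftClosed {1} {r} c
    c-leftClosed zero = zero , FP.↑ʳ-injective m _ _
      (trans (sym (⊕-lookupʳ a c zero)) (trans (cong (λ v → lookup v (pivot m r)) a⊕c≡ι) fix))
  ... | o , b , o⊕b≡c = a , b , trans (cong (a ⊕_) (trans (cong (_⊕ b) (sym (word1 o))) o⊕b≡c)) a⊕c≡ι

module Evenness where
  open Sums ℕP.+-*-commutativeSemiring
  open ≡-Reasoning

  ∑-ones : ∀ n → ∑[ i ∈ allFin n ] 1 ≡ n
  ∑-ones zero    = refl
  ∑-ones (suc n) = trans (∑-allFin-suc {n} (λ _ → 1)) (cong suc (∑-ones n))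

  -- A fixed-point-free involution pairs the positions with ι(i) < i with the
  -- positions with i < ι(i), so there are equally many of both kinds.
  fixed-point-free-even : ∀ {n} (ι : Word n) → IsInvolution ι → IsFixedPointFree ι → ∃ λ k → n ≡ k +ℕ k
  fixed-point-free-even {n} ι inv fpf = descents , (begin
    n                                                  ≡⟨ ∑-ones n ⟨
    ∑[ i ∈ allFin n ] 1                                ≡⟨ ∑-cong (allFin n) one-side ⟨
    ∑[ i ∈ allFin n ] (below i +ℕ above i)             ≡⟨ ∑-+ (allFin n) below above ⟩
    descents +ℕ ∑ (allFin n) above                     ≡⟨ cong (descents +ℕ_) (∑-involution ι inv above) ⟨
    descents +ℕ ∑[ j ∈ allFin n ] above (lookup ι j)   ≡⟨ cong (descents +ℕ_) (∑-cong (allFin n) (λ j →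
                                                            cong (λ x → when (ltᵇ (lookup ι j) x) 1) (inv j))) ⟩
    descents +ℕ descents                               ∎)
    where
    below above : Fin n → ℕ
    below i = when (ltᵇ (lookup ι i) i) 1
    above i = when (ltᵇ i (lookup ι i)) 1
    descents = ∑ (allFin n) below
    one-side : ∀ i → below i +ℕ above i ≡ 1
    one-side i with FP.<-cmp (lookup ι i) i
    ... | tri< lt _ ¬gt = cong₂ (λ b b′ → when b 1 +ℕ when b′ 1)
      (Equivalence.from (ltᵇ-decides _ _) lt) (decides-false (ltᵇ-decides _ _) ¬gt)
    ... | tri≈ _ eq _ = ⊥-elim (fpf i eq)
    ... | tri> ¬lt _ gt = cong₂ (λ b b′ → when b 1 +ℕ when b′ 1)
      (decides-false (ltᵇ-decides _ _) ¬lt) (Equivalence.from (ltᵇ-decides _ _) gt)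

  even≢odd : ∀ j k → ¬ (j +ℕ j ≡ suc (k +ℕ k))
  even≢odd j k eq = ℕP.<-irrefl k≡1+k (ℕP.n<1+n k)
    where
    k≡1+k : k ≡ suc k
    k≡1+k = begin
      k                    ≡⟨ ℕP.n≡⌈n+n/2⌉ k ⟩
      ⌈ k +ℕ k /2⌉         ≡⟨ cong ⌊_/2⌋ eq ⟨
      ⌊ j +ℕ j /2⌋         ≡⟨ ℕP.n≡⌊n+n/2⌋ j ⟨
      j                    ≡⟨ ℕP.n≡⌈n+n/2⌉ j ⟩
      ⌈ j +ℕ j /2⌉         ≡⟨ cong ⌈_/2⌉ eq ⟩
      suc ⌊ k +ℕ k /2⌋     ≡⟨ cong suc (ℕP.n≡⌊n+n/2⌋ k) ⟨
      suc k                ∎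

  odd-not-fixed-point-free : ∀ k (ι : Word (suc (k +ℕ k))) →
    (isInvolution ι ∧ isFixedPointFree ι ∧ avoids321 ι) ≡ false
  odd-not-fixed-point-free k ι = decides-false
    (∧-decides (isInvolution-decides ι) (∧-decides (isFixedPointFree-decides ι) (avoids321-decides ι)))
    (λ { (inv , fpf , _) → let (j , eq) = fixed-point-free-even ι inv fpf in even≢odd j k (sym eq) })

∧-shuffle : ∀ ia ib aa ab fa → ((ia ∧ ib) ∧ (aa ∧ ab)) ∧ fa ≡ (ia ∧ fa ∧ aa) ∧ (ib ∧ ab)
∧-shuffle ia ib aa ab fa = begin
  ((ia ∧ ib) ∧ (aa ∧ ab)) ∧ fa   ≡⟨ cong (_∧ fa) (interchange ia ib aa ab) ⟩
  ((ia ∧ aa) ∧ (ib ∧ ab)) ∧ fa   ≡⟨ BP.∧-assoc (ia ∧ aa) _ fa ⟩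
  (ia ∧ aa) ∧ ((ib ∧ ab) ∧ fa)   ≡⟨ cong ((ia ∧ aa) ∧_) (BP.∧-comm (ib ∧ ab) fa) ⟩
  (ia ∧ aa) ∧ (fa ∧ (ib ∧ ab))   ≡⟨ BP.∧-assoc (ia ∧ aa) fa _ ⟨
  ((ia ∧ aa) ∧ fa) ∧ (ib ∧ ab)   ≡⟨ cong (_∧ (ib ∧ ab)) (BP.∧-assoc ia aa fa) ⟩
  (ia ∧ aa ∧ fa) ∧ (ib ∧ ab)     ≡⟨ cong (λ x → (ia ∧ x) ∧ (ib ∧ ab)) (BP.∧-comm aa fa) ⟩
  (ia ∧ fa ∧ aa) ∧ (ib ∧ ab)     ∎
  where
  open ≡-Reasoning
  open import Algebra.Properties.CommutativeSemigroup
    (CommutativeMonoid.commutativeSemigroup BP.∧-commutativeMonoid) using (interchange)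

isInv321 : ∀ {n} → Word n → Bool
isInv321 ι = isInvolution ι ∧ avoids321 ι

isFInv321 : ∀ {n} → Word n → Bool
isFInv321 ι = isInvolution ι ∧ isFixedPointFree ι ∧ avoids321 ι

isInv321-firstFixedAt : ∀ {n} → ℕ → Word n → Bool
isInv321-firstFixedAt m ι = isInv321 ι ∧ firstFixedAt ι m

module _ {m r : ℕ} where

  isInv321-firstFixedAt-⊕ : (a : Word m) (b : Word r) →
    isInv321-firstFixedAt m (a ⊕ (one ⊕ b)) ≡ isFInv321 a ∧ isInv321 b
  isInv321-firstFixedAt-⊕ a b = begin
    (isInvolution (a ⊕ (one ⊕ b)) ∧ avoids321 (a ⊕ (one ⊕ b))) ∧ firstFixedAt (a ⊕ (one ⊕ b)) m
      ≡⟨ cong₂ _∧_ (cong₂ _∧_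
           (trans (⊕-isInvolution a (one ⊕ b)) (cong (isInvolution a ∧_) (⊕-isInvolution one b)))
           (trans (⊕-avoids321 a (one ⊕ b)) (cong (avoids321 a ∧_) (⊕-avoids321 one b))))
         (firstFixedAt-⊕ a b) ⟩
    ((isInvolution a ∧ isInvolution b) ∧ (avoids321 a ∧ avoids321 b)) ∧ isFixedPointFree a
      ≡⟨ ∧-shuffle (isInvolution a) (isInvolution b) (avoids321 a) (avoids321 b) (isFixedPointFree a) ⟩
    isFInv321 a ∧ isInv321 b ∎
    where open ≡-Reasoning

  isInv321-firstFixedAt-onto : (ι : Word (m +ℕ suc r)) → isInv321-firstFixedAt m ι ≡ true →
                               ∃₂ λ a b → a ⊕ (one ⊕ b) ≡ ι
  isInv321-firstFixedAt-onto ι test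
    with Equivalence.to (∧-decides (∧-decides (isInvolution-decides ι) (avoids321-decides ι))
                                   (∧-decides (fixedAt-decides ι m) (mk⇔ (λ e → e) (λ e → e)))) test
  ... | (inv , avoid) , ((x , x≡m , fix) , _) = fixed-point-decomposition ι inv avoid
    (subst (λ y → lookup ι y ≡ y) (FP.toℕ-injective (trans x≡m (sym (toℕ-pivot m r)))) fix)

  ⊕-one-injective : ∀ {a a′ : Word m} {b b′ : Word r} →
                    a ⊕ (one ⊕ b) ≡ a′ ⊕ (one ⊕ b′) → a ≡ a′ × b ≡ b′
  ⊕-one-injective {a} {a′} {b} {b′} eq =
    proj₁ outer , proj₂ (⊕-injective {a = one} {one} {b} {b′} (proj₂ outer))
    where
    outer = ⊕-injective {a = a} {a′} {one ⊕ b} {one ⊕ b′} eq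

split-around : ∀ {m n} → m < n → n ≡ m +ℕ suc (n ∸ m ∸ 1)
split-around {m} {n} m<n = sym (trans (cong (m +ℕ_) suc[n∸m∸1]≡n∸m) (ℕP.m+[n∸m]≡n (ℕP.<⇒≤ m<n)))
  where
  suc[n∸m∸1]≡n∸m : suc (n ∸ m ∸ 1) ≡ n ∸ m
  suc[n∸m∸1]≡n∸m = trans (sym (ℕP.+-∸-assoc 1 (ℕP.m<n⇒0<n∸m m<n))) (ℕP.m+n∸m≡n 1 (n ∸ m))

module Recursion {c ℓ : Level} (R : CommutativeSemiring c ℓ) (q : CommutativeSemiring.Carrier R) where
  open CommutativeSemiring R hiding (zero)
    renaming (refl to ≈-refl; sym to ≈-sym; trans to ≈-trans; reflexive to ≈-reflexive)
  open GF R
  open Sums R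
  open Inversions using (inv-⊕)
  open Evenness using (odd-not-fixed-point-free)
  open import Relation.Binary.Reasoning.Setoid (CommutativeSemiring.setoid R)

  weight : ∀ {n} → Word n → Carrier
  weight ι = pow q (inv ι)

  pow-+ : ∀ x y → pow q (x +ℕ y) ≈ pow q x * pow q y
  pow-+ zero    y = ≈-sym (*-identityˡ _)
  pow-+ (suc x) y = ≈-trans (*-congˡ (pow-+ x y)) (≈-sym (*-assoc _ _ _))

  weight-⊕ : ∀ {m r} (a : Word m) (b : Word r) → weight (a ⊕ (one ⊕ b)) ≈ weight a * weight b
  weight-⊕ a b = ≈-trans
    (≈-reflexive (cong (pow q) (trans (inv-⊕ a (one ⊕ b)) (cong (inv a +ℕ_) (inv-⊕ one b)))))
    (pow-+ (inv a) (inv b))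

  II-as-∑ : ∀ n → II q n ≈ ∑[ ι ∈ allVecs n n ] when (isInv321 ι) (weight ι)
  II-as-∑ n = sumR-filter isInv321 weight (allVecs n n)

  IF-as-∑ : ∀ n → IF q n ≈ ∑[ ι ∈ allVecs n n ] when (isFInv321 ι) (weight ι)
  IF-as-∑ n = sumR-filter isFInv321 weight (allVecs n n)

  IF-odd : ∀ k → IF q (suc (k +ℕ k)) ≈ 0#
  IF-odd k = ≈-trans (IF-as-∑ (suc (k +ℕ k))) (∑-vanish (allVecs _ _) (λ ι →
    ≈-reflexive (cong (λ b → when b (weight ι)) (odd-not-fixed-point-free k ι))))

  first-fixed-point-split : ∀ {n} (ι : Word n) →
    when (isInv321 ι) (weight ι)
      ≈ when (isFInv321 ι) (weight ι) + sumBelow n (λ k → when (isInv321-firstFixedAt k ι) (weight ι))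
  first-fixed-point-split {n} ι = begin
    when I W
      ≈⟨ when-cong I (when-split (anyBelow (fixedAt ι) n) W) ⟩
    when I (when (not (anyBelow (fixedAt ι) n)) W + when (anyBelow (fixedAt ι) n) W)
      ≈⟨ when-cong I (+-cong (≈-reflexive (cong (λ b → when b W) (sym (isFixedPointFree-anyBelow ι))))
                             (≈-sym (sumBelow-first (fixedAt ι) W n))) ⟩
    when I (when (isFixedPointFree ι) W + sumBelow n (λ k → when (firstFixedAt ι k) W))
      ≈⟨ when-+ I _ _ ⟩
    when I (when (isFixedPointFree ι) W) + when I (sumBelow n (λ k → when (firstFixedAt ι k) W))
      ≈⟨ +-cong (≈-reflexive (sym (when-∧ I (isFixedPointFree ι) W)))
                (≈-sym (sumBelow-when I n (λ k → when (firstFixedAt ι k) W))) ⟩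
    when (I ∧ isFixedPointFree ι) W + sumBelow n (λ k → when I (when (firstFixedAt ι k) W))
      ≈⟨ +-cong (≈-reflexive (cong (λ b → when b W) (I∧F≡isFInv321)))
                (sumBelow-cong n (λ k _ → ≈-reflexive (sym (when-∧ I (firstFixedAt ι k) W)))) ⟩
    when (isFInv321 ι) W + sumBelow n (λ k → when (isInv321-firstFixedAt k ι) W) ∎
    where
    I = isInv321 ι
    W = weight ι
    I∧F≡isFInv321 : I ∧ isFixedPointFree ι ≡ isFInv321 ι
    I∧F≡isFInv321 = trans (BP.∧-assoc (isInvolution ι) _ _)
      (cong (isInvolution ι ∧_) (BP.∧-comm (avoids321 ι) (isFixedPointFree ι)))

  first-fixed-point-term : ∀ m r →
    ∑[ ι ∈ allVecs (m +ℕ suc r) (m +ℕ suc r) ] when (isInv321-firstFixedAt m ι) (weight ι) ≈ IF q m * II q r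
  first-fixed-point-term m r = begin
    ∑[ ι ∈ allVecs (m +ℕ suc r) (m +ℕ suc r) ] when (isInv321-firstFixedAt m ι) (weight ι)
      ≈⟨ ∑-change-of-variables (λ a b → a ⊕ (one ⊕ b)) (⊕-one-injective {m} {r})
           (isInv321-firstFixedAt m) (isInv321-firstFixedAt-onto {m} {r}) weight ⟩
    ∑[ a ∈ As ] ∑[ b ∈ Bs ] when (isInv321-firstFixedAt m (a ⊕ (one ⊕ b))) (weight (a ⊕ (one ⊕ b)))
      ≈⟨ ∑-cong As (λ a → ∑-cong Bs (λ b → ≈-trans
           (≈-reflexive (cong (λ t → when t (weight (a ⊕ (one ⊕ b)))) (isInv321-firstFixedAt-⊕ a b)))
           (≈-trans (when-cong (isFInv321 a ∧ isInv321 b) (weight-⊕ a b))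
                    (when-* (isFInv321 a) (isInv321 b) (weight a) (weight b))))) ⟩
    ∑[ a ∈ As ] ∑[ b ∈ Bs ] (when (isFInv321 a) (weight a) * when (isInv321 b) (weight b))
      ≈⟨ ∑-product As Bs _ _ ⟨
    ∑[ a ∈ As ] when (isFInv321 a) (weight a) * ∑[ b ∈ Bs ] when (isInv321 b) (weight b)
      ≈⟨ *-cong (IF-as-∑ m) (II-as-∑ r) ⟨
    IF q m * II q r ∎
    where
    As = allVecs m m
    Bs = allVecs r r

  recursion : ∀ n → II q n ≈ IF q n + sumBelow ⌈ n /2⌉ (λ k → IF q (2 *ℕ k) * II q (n ∸ (2 *ℕ k) ∸ 1))
  recursion n = begin
    II q n
      ≈⟨ II-as-∑ n ⟩
    ∑[ ι ∈ Ws ] when (isInv321 ι) (weight ι)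
      ≈⟨ ∑-cong Ws first-fixed-point-split ⟩
    ∑[ ι ∈ Ws ] (when (isFInv321 ι) (weight ι) + sumBelow n (term ι))
      ≈⟨ ∑-+ Ws _ _ ⟩
    ∑[ ι ∈ Ws ] when (isFInv321 ι) (weight ι) + ∑[ ι ∈ Ws ] sumBelow n (term ι)
      ≈⟨ +-cong (≈-sym (IF-as-∑ n)) (∑-sumBelow Ws n term) ⟩
    IF q n + sumBelow n (λ k → ∑[ ι ∈ Ws ] term ι k)
      ≈⟨ +-congˡ (sumBelow-cong n (λ k k<n → ≈-trans
           (≈-reflexive (cong (λ N → ∑[ ι ∈ allVecs N N ] term ι k) (split-around k<n)))
           (first-fixed-point-term k (n ∸ k ∸ 1)))) ⟩
    IF q n + sumBelow n (λ k → IF q k * II q (n ∸ k ∸ 1))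
      ≈⟨ +-congˡ (sumBelow-evens (λ k → IF q k * II q (n ∸ k ∸ 1))
           (λ k → ≈-trans (*-congʳ (IF-odd k)) (zeroˡ _)) n) ⟩
    IF q n + sumBelow ⌈ n /2⌉ (λ k → IF q (2 *ℕ k) * II q (n ∸ (2 *ℕ k) ∸ 1)) ∎
    where
    Ws = allVecs n n
    term : ∀ {N} → Word N → ℕ → Carrier
    term ι k = when (isInv321-firstFixedAt k ι) (weight ι)

-- Proposition 3.15.  II₁ = 1 by direct computation; the recursion in fact
-- holds for every n.
proposition3p15 : ∀ {c ℓ : Level} (R : CommutativeSemiring c ℓ) (q : CommutativeSemiring.Carrier R) →
    let open CommutativeSemiring R
        open GF R
    in (II q 1 ≈ 1#)
       × (∀ (n : ℕ) → 1 < n →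
            II q n ≈ IF q n + sumBelow ⌈ n /2⌉ (λ k → IF q (2 *ℕ k) * II q (n ∸ (2 *ℕ k) ∸ 1)))
proposition3p15 R q = CommutativeSemiring.+-identityʳ R _ , λ n _ → recursion n
  where open Recursion R q
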